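{- For every $n\geq1$, the set $\mathfrak{S}_n(2134,2143)$ is invariant under the MFS-action, i.e., $\varphi'_a(\pi)\in\mathfrak{S}_n(2134,2143)$ for every $\pi\in\mathfrak{S}_n(2134,2143)$ and every $a\in[n]$.
   Context: $\mathfrak{S}_n$ is the set of permutations of $[n]$; $\mathfrak{S}_n(p_1,\dots,p_r)$ is the set of those containing no subsequence order isomorphic to any $p_i$. For $\pi\in\mathfrak{S}_n$ and $a\in[n]$, factor $\pi=w_1w_2aw_3w_4$ where $w_2$ (resp. $w_3$) is the maximal contiguous (possibly empty) factor immediately left (resp. right) of $a$ all of whose letters exceed $a$; the Foata–Strehl action is $\varphi_a(\pi)=w_1w_3aw_2w_4$. With $\pi_0=\pi_{n+1}=-\infty$ and $i=\pi^{ -1}(a)$, the modified Foata–Strehl (MFS) action is $\varphi'_a(\pi)=\varphi_a(\pi)$ if $\pi_{i-1}<\pi_i<\pi_{i+1}$ or $\pi_{i-1}>\pi_i>\pi_{i+1}$, and $\varphi'_a(\pi)=\pi$ otherwise. A set is invariant under the MFS-action if it is closed under every $\varphi'_a$. -}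

module Defs where

open import Data.Nat using (ℕ; zero; suc; _<_; _≡ᵇ_; _<ᵇ_)
open import Data.Bool using (Bool; true; false; not; _∧_; _∨_; if_then_else_)
open import Data.Maybe using (Maybe; just; nothing)
open import Data.List using (List; []; _∷_; _++_; length; lookup; map; upTo; reverse; head; last;
  takeWhileᵇ; dropWhileᵇ; spanᵇ)
open import Data.List.Relation.Unary.All using (All)
open import Data.List.Relation.Binary.Permutation.Propositional using (_↭_)
open import Data.List.Relation.Binary.Sublist.Propositional using (_⊆_)
open import Data.Fin using (Fin; cast)
open import Data.Product using (Σ; ∃; _×_; _,_)
open import Function.Bundles using (_⇔_)
open import Relation.Binary.PropositionalEquality using (_≡_)
open import Relation.Nullary using (¬_)

-- A permutation of [n] = {1,…,n}, written in one-line notation as a list.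
IsPerm : ℕ → List ℕ → Set
IsPerm n π = π ↭ map suc (upTo n)

OrderIso : List ℕ → List ℕ → Set
OrderIso σ p = Σ (length σ ≡ length p) λ eq →
  ∀ (i j : Fin (length σ)) →
    (lookup σ i < lookup σ j) ⇔ (lookup p (cast eq i) < lookup p (cast eq j))

Contains : List ℕ → List ℕ → Set
Contains π p = ∃ λ σ → (σ ⊆ π) × OrderIso σ p

Avoids : List ℕ → List (List ℕ) → Set
Avoids π ps = All (λ p → ¬ Contains π p) ps

-- Factorisation π = w1 w2 a w3 w4 (assuming a occurs in π).
-- pre = w1 w2 , post = w3 w4.
pre : ℕ → List ℕ → List ℕ
pre a π = Data.Product.proj₁ (spanᵇ (λ x → not (x ≡ᵇ a)) π)

post : ℕ → List ℕ → List ℕ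
post a π with Data.Product.proj₂ (spanᵇ (λ x → not (x ≡ᵇ a)) π)
... | []     = []
... | _ ∷ ys = ys

w2 : ℕ → List ℕ → List ℕ
w2 a π = reverse (takeWhileᵇ (a <ᵇ_) (reverse (pre a π)))

w1 : ℕ → List ℕ → List ℕ
w1 a π = reverse (dropWhileᵇ (a <ᵇ_) (reverse (pre a π)))

w3 : ℕ → List ℕ → List ℕ
w3 a π = takeWhileᵇ (a <ᵇ_) (post a π)

w4 : ℕ → List ℕ → List ℕ
w4 a π = dropWhileᵇ (a <ᵇ_) (post a π)

φ : ℕ → List ℕ → List ℕ
φ a π = w1 a π ++ w3 a π ++ a ∷ w2 a π ++ w4 a π

-- Comparisons with the neighbours of a, using π₀ = π_{n+1} = -∞
-- (a missing neighbour is represented by nothing).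
-- left neighbour < a
leftLess : Maybe ℕ → ℕ → Bool
leftLess nothing  a = true
leftLess (just x) a = x <ᵇ a

leftGreater : Maybe ℕ → ℕ → Bool
leftGreater nothing  a = false
leftGreater (just x) a = a <ᵇ x

rightGreater : ℕ → Maybe ℕ → Bool
rightGreater a nothing  = false
rightGreater a (just y) = a <ᵇ y

rightLess : ℕ → Maybe ℕ → Bool
rightLess a nothing  = true
rightLess a (just y) = y <ᵇ a

isDoubleAscOrDesc : ℕ → List ℕ → Bool
isDoubleAscOrDesc a π =
  (leftLess (last (pre a π)) a ∧ rightGreater a (head (post a π)))
  ∨ (leftGreater (last (pre a π)) a ∧ rightLess a (head (post a π)))

φ′ : ℕ → List ℕ → List ℕ
φ′ a π = if isDoubleAscOrDesc a π then φ a π else π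

module Submission where

-- Both patterns say x₂ < x₁ < x₃, x₄ and differ only in the order of their last two
-- letters; moreover x₂, the smallest letter, may be replaced by any smaller one.
-- At a double ascent (descent) a, the action φ′ moves a rightwards past w3 (leftwards
-- past w2), a block of letters larger than a, and the letter just beyond that block,
-- the first of w4 (the last of w1), is at most a. An occurrence in φ′(π) that does
-- not use both a and a letter z of that block already lies in π. Otherwise a and z
-- appear in the order opposite to π, and comparing with the two patterns shows that
-- either a plays the role of the 1, and replacing it by that letter gives an
-- occurrence in π, or a and z are the last two letters, and in π they form an
-- occurrence of the other pattern.

open import Defs
open import Data.Bool using (T; true; false)
open import Data.Bool.Properties using (T-∨; T-∧)
open import Data.Empty using (⊥-elim)
open import Data.Fin.Patterns using (0F; 1F; 2F; 3F)
open import Data.List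
  using (List; []; _∷_; _++_; length; head; last; reverse; takeWhileᵇ; dropWhileᵇ; initLast; _∷ʳ′_)
open import Data.List.Properties
  using (++-assoc; ++-conicalˡ; ++-conicalʳ; unfold-reverse; reverse-++; reverse-involutive;
         takeWhile++dropWhile)
open import Data.List.Membership.Propositional using (_∈_)
open import Data.List.Membership.Propositional.Properties using (∈-++⁻; ∈-map⁺; ∈-upTo⁺)
open import Data.List.Relation.Binary.Permutation.Propositional
  using (_↭_; ↭-sym; ↭-trans; ↭-reflexive)
open import Data.List.Relation.Binary.Permutation.Propositional.Properties
  using (∈-resp-↭; All-resp-↭; ↭-reverse; shift; shifts)
  renaming (++⁺ˡ to ↭-++⁺ˡ)
open import Data.List.Relation.Binary.Sublist.Propositional
  using (_⊆_; []; _∷_; _∷ʳ_; minimum; from∈; to∈)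
open import Data.List.Relation.Binary.Sublist.Propositional.Properties
  using (++⁺; ++⁺ˡ; ∷ʳ⁻; All-resp-⊆)
open import Data.List.Relation.Unary.All as All using (All; []; _∷_)
open import Data.List.Relation.Unary.All.Properties using (all-takeWhile; all-head-dropWhile)
open import Data.List.Relation.Unary.Any using (here; there)
open import Data.Maybe using (just; nothing)
import Data.Maybe.Relation.Unary.All as Maybe
open import Data.Nat using (ℕ; suc; s≤s; _≤_; _<_; _<ᵇ_; _≡ᵇ_)
open import Data.Nat.Properties
  using (<-trans; <-asym; <-irrefl; ≤-<-trans; >⇒≢; <ᵇ⇒<; <⇒<ᵇ; ≮⇒≥; ≡ᵇ⇒≡; ≡⇒≡ᵇ)
open import Data.Product using (∃; ∃₂; _×_; _,_; proj₁; proj₂)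
open import Data.Sum using (_⊎_; inj₁; inj₂)
open import Data.Unit using (tt)
open import Function using (_∘_)
open import Function.Bundles using (_⇔_; mk⇔; module Equivalence)
open import Relation.Binary.PropositionalEquality
  using (_≡_; refl; sym; trans; cong; cong₂; subst; module ≡-Reasoning)
open import Relation.Nullary using (¬_)
open import Relation.Nullary.Decidable using (T?)

private
  variable
    A : Set
    a b u x y z x₁ x₂ x₃ x₄ x′ y′ y₁ y₂ y₃ y₄ : ℕ
    r vs ws xs L M R π : List ℕ

⊆-++-split : ∀ (ys : List A) {zs xs} → xs ⊆ ys ++ zs →
  ∃₂ λ us vs → xs ≡ us ++ vs × us ⊆ ys × vs ⊆ zs
⊆-++-split [] p = [] , _ , refl , [] , p
⊆-++-split (y ∷ ys) (.y ∷ʳ p) with ⊆-++-split ys p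
... | us , vs , refl , us⊆ , vs⊆ = us , vs , refl , y ∷ʳ us⊆ , vs⊆
⊆-++-split (y ∷ ys) (x≡y ∷ p) with ⊆-++-split ys p
... | us , vs , refl , us⊆ , vs⊆ = _ ∷ us , vs , refl , x≡y ∷ us⊆ , vs⊆

⊆-skip-smaller : All (b <_) ws → ws ⊆ b ∷ R → ws ⊆ R
⊆-skip-smaller [] _ = minimum _
⊆-skip-smaller (b<w ∷ _) p = ∷ʳ⁻ (>⇒≢ b<w) p

last-snoc : ∀ (xs : List A) x → last (xs ++ x ∷ []) ≡ just x
last-snoc [] x = refl
last-snoc (_ ∷ []) x = refl
last-snoc (_ ∷ _ ∷ xs) x = last-snoc (_ ∷ xs) x

last-reverse : ∀ (xs : List A) → last (reverse xs) ≡ head xs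
last-reverse [] = refl
last-reverse (x ∷ xs) = trans (cong last (unfold-reverse x xs)) (last-snoc (reverse xs) x)

↭-swapAround : ∀ (x : A) us vs ws → us ++ x ∷ vs ++ ws ↭ vs ++ x ∷ us ++ ws
↭-swapAround x us vs ws = ↭-trans (shifts us (x ∷ vs)) (↭-sym (shift x vs (us ++ ws)))

data Forbidden : List ℕ → Set where
  ⟨2134⟩ : x₂ < x₁ → x₁ < x₃ → x₃ < x₄ → Forbidden (x₁ ∷ x₂ ∷ x₃ ∷ x₄ ∷ [])
  ⟨2143⟩ : x₂ < x₁ → x₁ < x₄ → x₄ < x₃ → Forbidden (x₁ ∷ x₂ ∷ x₃ ∷ x₄ ∷ [])

second<first : Forbidden (x₁ ∷ x₂ ∷ r) → x₂ < x₁
second<first (⟨2134⟩ x₂<x₁ _ _) = x₂<x₁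
second<first (⟨2143⟩ x₂<x₁ _ _) = x₂<x₁

first<rest : Forbidden (x₁ ∷ x₂ ∷ r) → All (x₁ <_) r
first<rest (⟨2134⟩ _ x₁<x₃ x₃<x₄) = x₁<x₃ ∷ <-trans x₁<x₃ x₃<x₄ ∷ []
first<rest (⟨2143⟩ _ x₁<x₄ x₄<x₃) = <-trans x₁<x₄ x₄<x₃ ∷ x₁<x₄ ∷ []

second<rest : Forbidden (x₁ ∷ x₂ ∷ r) → All (x₂ <_) r
second<rest f = All.map (<-trans (second<first f)) (first<rest f)

lowerSecond : Forbidden (x₁ ∷ x₂ ∷ r) → y ≤ x₂ → Forbidden (x₁ ∷ y ∷ r)
lowerSecond (⟨2134⟩ x₂<x₁ p q) y≤x₂ = ⟨2134⟩ (≤-<-trans y≤x₂ x₂<x₁) p q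
lowerSecond (⟨2143⟩ x₂<x₁ p q) y≤x₂ = ⟨2143⟩ (≤-<-trans y≤x₂ x₂<x₁) p q

swapLast : Forbidden (x₁ ∷ x₂ ∷ x₃ ∷ x₄ ∷ r) → Forbidden (x₁ ∷ x₂ ∷ x₄ ∷ x₃ ∷ r)
swapLast (⟨2134⟩ p q s) = ⟨2143⟩ p q s
swapLast (⟨2143⟩ p q s) = ⟨2134⟩ p q s

-- The inversions of 2134 and 2143 sit at positions (1,2) and (3,4).
inversionPositions : ∀ us vs → Forbidden (us ++ x ∷ vs ++ y ∷ ws) → y < x →
  (us ≡ [] × vs ≡ []) ⊎ ∃₂ (λ u₁ u₂ → us ≡ u₁ ∷ u₂ ∷ [] × vs ≡ [])
inversionPositions [] [] _ _ = inj₁ (refl , refl)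
inversionPositions [] (_ ∷ []) f y<x = ⊥-elim (<-asym (All.head (first<rest f)) y<x)
inversionPositions [] (_ ∷ _ ∷ []) f y<x = ⊥-elim (<-asym (All.head (All.tail (first<rest f))) y<x)
inversionPositions [] (_ ∷ _ ∷ _ ∷ []) ()
inversionPositions [] (_ ∷ _ ∷ _ ∷ _ ∷ _) ()
inversionPositions (_ ∷ []) [] f y<x = ⊥-elim (<-asym (All.head (second<rest f)) y<x)
inversionPositions (_ ∷ []) (_ ∷ []) f y<x = ⊥-elim (<-asym (All.head (All.tail (second<rest f))) y<x)
inversionPositions (_ ∷ []) (_ ∷ _ ∷ []) ()
inversionPositions (_ ∷ []) (_ ∷ _ ∷ _ ∷ _) ()
inversionPositions (u₁ ∷ u₂ ∷ []) [] _ _ = inj₂ (u₁ , u₂ , refl , refl)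
inversionPositions (_ ∷ _ ∷ []) (_ ∷ []) ()
inversionPositions (_ ∷ _ ∷ []) (_ ∷ _ ∷ _) ()
inversionPositions (_ ∷ _ ∷ _ ∷ []) [] ()
inversionPositions (_ ∷ _ ∷ _ ∷ []) (_ ∷ _) ()
inversionPositions (_ ∷ _ ∷ _ ∷ _ ∷ []) _ ()
inversionPositions (_ ∷ _ ∷ _ ∷ _ ∷ _ ∷ _) _ ()

-- Their ascents between neighbours sit at positions (2,3) and (3,4).
adjacentAscentPositions : ∀ us → Forbidden (us ++ x ∷ y ∷ vs) → x < y →
  (∃ λ u → us ≡ u ∷ []) ⊎ ∃₂ (λ u₁ u₂ → us ≡ u₁ ∷ u₂ ∷ [] × vs ≡ [])
adjacentAscentPositions [] f x<y = ⊥-elim (<-asym x<y (second<first f))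
adjacentAscentPositions (u ∷ []) _ _ = inj₁ (u , refl)
adjacentAscentPositions (u₁ ∷ u₂ ∷ []) (⟨2134⟩ _ _ _) _ = inj₂ (u₁ , u₂ , refl , refl)
adjacentAscentPositions (_ ∷ _ ∷ []) (⟨2143⟩ _ _ x₄<x₃) x₃<x₄ = ⊥-elim (<-asym x₃<x₄ x₄<x₃)
adjacentAscentPositions (_ ∷ _ ∷ _ ∷ []) ()
adjacentAscentPositions (_ ∷ _ ∷ _ ∷ _ ∷ []) ()
adjacentAscentPositions (_ ∷ _ ∷ _ ∷ _ ∷ _ ∷ _) ()

data SameOrder (x y x′ y′ : ℕ) : Set where
  both< : x < y → x′ < y′ → SameOrder x y x′ y′
  both> : y < x → y′ < x′ → SameOrder x y x′ y′

sameOrder⇒⇔ : SameOrder x y x′ y′ → (x < y) ⇔ (x′ < y′)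
sameOrder⇒⇔ (both< x<y x′<y′) = mk⇔ (λ _ → x′<y′) (λ _ → x<y)
sameOrder⇒⇔ (both> y<x y′<x′) =
  mk⇔ (λ x<y → ⊥-elim (<-asym x<y y<x)) (λ x′<y′ → ⊥-elim (<-asym x′<y′ y′<x′))

sameOrder-sym : SameOrder x y x′ y′ → SameOrder y x y′ x′
sameOrder-sym (both< x<y x′<y′) = both> x<y x′<y′
sameOrder-sym (both> y<x y′<x′) = both< y<x y′<x′

<-irrefl-⇔ : (x < x) ⇔ (y < y)
<-irrefl-⇔ = mk⇔ (λ x<x → ⊥-elim (<-irrefl refl x<x)) (λ y<y → ⊥-elim (<-irrefl refl y<y))

orderIso₄ : SameOrder x₁ x₂ y₁ y₂ → SameOrder x₁ x₃ y₁ y₃ → SameOrder x₁ x₄ y₁ y₄ →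
            SameOrder x₂ x₃ y₂ y₃ → SameOrder x₂ x₄ y₂ y₄ → SameOrder x₃ x₄ y₃ y₄ →
            OrderIso (x₁ ∷ x₂ ∷ x₃ ∷ x₄ ∷ []) (y₁ ∷ y₂ ∷ y₃ ∷ y₄ ∷ [])
orderIso₄ s₁₂ s₁₃ s₁₄ s₂₃ s₂₄ s₃₄ = refl , λ where
  0F 0F → <-irrefl-⇔
  0F 1F → sameOrder⇒⇔ s₁₂
  0F 2F → sameOrder⇒⇔ s₁₃
  0F 3F → sameOrder⇒⇔ s₁₄
  1F 0F → sameOrder⇒⇔ (sameOrder-sym s₁₂)
  1F 1F → <-irrefl-⇔
  1F 2F → sameOrder⇒⇔ s₂₃
  1F 3F → sameOrder⇒⇔ s₂₄
  2F 0F → sameOrder⇒⇔ (sameOrder-sym s₁₃)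
  2F 1F → sameOrder⇒⇔ (sameOrder-sym s₂₃)
  2F 2F → <-irrefl-⇔
  2F 3F → sameOrder⇒⇔ s₃₄
  3F 0F → sameOrder⇒⇔ (sameOrder-sym s₁₄)
  3F 1F → sameOrder⇒⇔ (sameOrder-sym s₂₄)
  3F 2F → sameOrder⇒⇔ (sameOrder-sym s₃₄)
  3F 3F → <-irrefl-⇔

-- For numerals m and n the hidden argument has type ⊤ and is inferred.
<-num : ∀ {m n} {m<n : T (m <ᵇ n)} → m < n
<-num {m} {n} {m<n} = <ᵇ⇒< m n m<n

forbidden⇒orderIso : Forbidden xs →
  OrderIso xs (2 ∷ 1 ∷ 3 ∷ 4 ∷ []) ⊎ OrderIso xs (2 ∷ 1 ∷ 4 ∷ 3 ∷ [])
forbidden⇒orderIso (⟨2134⟩ x₂<x₁ x₁<x₃ x₃<x₄) = inj₁ (orderIso₄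
  (both> x₂<x₁ <-num) (both< x₁<x₃ <-num) (both< (<-trans x₁<x₃ x₃<x₄) <-num)
  (both< x₂<x₃ <-num) (both< (<-trans x₂<x₃ x₃<x₄) <-num) (both< x₃<x₄ <-num))
  where x₂<x₃ = <-trans x₂<x₁ x₁<x₃
forbidden⇒orderIso (⟨2143⟩ x₂<x₁ x₁<x₄ x₄<x₃) = inj₂ (orderIso₄
  (both> x₂<x₁ <-num) (both< (<-trans x₁<x₄ x₄<x₃) <-num) (both< x₁<x₄ <-num)
  (both< (<-trans x₂<x₄ x₄<x₃) <-num) (both< x₂<x₄ <-num) (both> x₄<x₃ <-num))
  where x₂<x₄ = <-trans x₂<x₁ x₁<x₄

length≡4⇒shape : ∀ (xs : List A) → length xs ≡ 4 →
  ∃₂ λ x₁ x₂ → ∃₂ λ x₃ x₄ → xs ≡ x₁ ∷ x₂ ∷ x₃ ∷ x₄ ∷ []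
length≡4⇒shape (_ ∷ _ ∷ _ ∷ _ ∷ []) _ = _ , _ , _ , _ , refl
length≡4⇒shape [] ()
length≡4⇒shape (_ ∷ []) ()
length≡4⇒shape (_ ∷ _ ∷ []) ()
length≡4⇒shape (_ ∷ _ ∷ _ ∷ []) ()
length≡4⇒shape (_ ∷ _ ∷ _ ∷ _ ∷ _ ∷ _) ()

orderIso⇒forbidden : OrderIso xs (2 ∷ 1 ∷ 3 ∷ 4 ∷ []) ⊎ OrderIso xs (2 ∷ 1 ∷ 4 ∷ 3 ∷ []) →
  Forbidden xs
orderIso⇒forbidden {xs} (inj₁ (eq , iso)) with length≡4⇒shape xs eq
... | _ , _ , _ , _ , refl =
  ⟨2134⟩ (from (iso 1F 0F) <-num) (from (iso 0F 2F) <-num) (from (iso 2F 3F) <-num)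
  where open Equivalence
orderIso⇒forbidden {xs} (inj₂ (eq , iso)) with length≡4⇒shape xs eq
... | _ , _ , _ , _ , refl =
  ⟨2143⟩ (from (iso 1F 0F) <-num) (from (iso 0F 3F) <-num) (from (iso 3F 2F) <-num)
  where open Equivalence

ContainsForbidden : List ℕ → Set
ContainsForbidden w = ∃ λ xs → xs ⊆ w × Forbidden xs

forbiddenPatterns : List (List ℕ)
forbiddenPatterns = (2 ∷ 1 ∷ 3 ∷ 4 ∷ []) ∷ (2 ∷ 1 ∷ 4 ∷ 3 ∷ []) ∷ []

avoids⇒¬containsForbidden : Avoids L forbiddenPatterns → ¬ ContainsForbidden L
avoids⇒¬containsForbidden (¬2134 ∷ ¬2143 ∷ []) (xs , xs⊆ , f) with forbidden⇒orderIso f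
... | inj₁ iso = ¬2134 (xs , xs⊆ , iso)
... | inj₂ iso = ¬2143 (xs , xs⊆ , iso)

¬containsForbidden⇒avoids : ¬ ContainsForbidden L → Avoids L forbiddenPatterns
¬containsForbidden⇒avoids ¬c =
  (λ (xs , xs⊆ , iso) → ¬c (xs , xs⊆ , orderIso⇒forbidden (inj₁ iso))) ∷
  (λ (xs , xs⊆ , iso) → ¬c (xs , xs⊆ , orderIso⇒forbidden (inj₂ iso))) ∷ []

⊆-moveLeft : xs ⊆ M ++ a ∷ R →
  xs ⊆ a ∷ M ++ R ⊎ ∃ λ z → ∃₂ λ zs ws → xs ≡ z ∷ zs ++ a ∷ ws × z ∷ zs ⊆ M × ws ⊆ R
⊆-moveLeft {M = M} {a = a} p with ⊆-++-split M p
... | us , _ , refl , us⊆ , a ∷ʳ vs⊆ = inj₁ (a ∷ʳ ++⁺ us⊆ vs⊆)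
... | [] , _ , refl , _ , refl ∷ ws⊆ = inj₁ (refl ∷ ++⁺ˡ M ws⊆)
... | z ∷ zs , a ∷ ws , refl , z∷zs⊆ , refl ∷ ws⊆ = inj₂ (z , zs , ws , refl , z∷zs⊆ , ws⊆)

⊆-moveRight : xs ⊆ a ∷ M ++ R →
  xs ⊆ M ++ a ∷ R ⊎ ∃ λ z → ∃₂ λ zs ws → xs ≡ a ∷ z ∷ zs ++ ws × z ∷ zs ⊆ M × ws ⊆ R
⊆-moveRight {a = a} {M = M} (a ∷ʳ p) with ⊆-++-split M p
... | _ , _ , refl , us⊆ , vs⊆ = inj₁ (++⁺ us⊆ (a ∷ʳ vs⊆))
⊆-moveRight {M = M} (refl ∷ p) with ⊆-++-split M p
... | [] , _ , refl , _ , ws⊆ = inj₁ (++⁺ˡ M (refl ∷ ws⊆))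
... | z ∷ zs , ws , refl , z∷zs⊆ , ws⊆ = inj₂ (z , zs , ws , refl , z∷zs⊆ , ws⊆)

lowerSecondTo-head : Forbidden (z ∷ a ∷ ws) → ws ⊆ R → Maybe.All (_≤ a) (head R) →
  ∃ λ vs → vs ⊆ R × Forbidden (z ∷ vs)
lowerSecondTo-head {R = []} () [] _
lowerSecondTo-head {R = c ∷ _} f ws⊆ (Maybe.just c≤a) =
  c ∷ _ , refl ∷ ⊆-skip-smaller (second<rest f′) ws⊆ , f′
  where f′ = lowerSecond f c≤a

lowerSecondTo-last : Forbidden (u ∷ a ∷ r) → u ∷ [] ⊆ L → Maybe.All (_≤ a) (last L) →
  ∃ λ b → u ∷ b ∷ [] ⊆ L × Forbidden (u ∷ b ∷ r)
lowerSecondTo-last {L = L} f u⊆L L≤a with initLast L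
lowerSecondTo-last f () _ | []
lowerSecondTo-last f u⊆L L≤a | L′ ∷ʳ′ b with subst (Maybe.All _) (last-snoc L′ b) L≤a
... | Maybe.just b≤a = b , ++⁺ u⊆L′ (refl ∷ []) , f′
  where
  f′ = lowerSecond f b≤a
  u⊆L′ : _ ∷ [] ⊆ L′
  u⊆L′ with ∈-++⁻ L′ (to∈ u⊆L)
  ... | inj₁ u∈L′ = from∈ u∈L′
  ... | inj₂ (here u≡b) = ⊥-elim (>⇒≢ (second<first f′) u≡b)

containsForbidden-moveLeft : All (a <_) M → Maybe.All (_≤ a) (head R) →
  ContainsForbidden (L ++ M ++ a ∷ R) → ContainsForbidden (L ++ a ∷ M ++ R)
containsForbidden-moveLeft {a = a} {L = L} a<M R≤a (_ , xs⊆ , f) with ⊆-++-split L xs⊆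
... | ys , _ , refl , ys⊆ , t⊆ with ⊆-moveLeft t⊆
...   | inj₁ t⊆′ = _ , ++⁺ ys⊆ t⊆′ , f
...   | inj₂ (z , zs , ws , refl , z∷zs⊆ , ws⊆)
        with inversionPositions ys zs f (All.head (All-resp-⊆ z∷zs⊆ a<M))
...     | inj₁ (refl , refl) =
          let vs , vs⊆ , f′ = lowerSecondTo-head f ws⊆ R≤a
          in _ , ++⁺ˡ L (a ∷ʳ ++⁺ z∷zs⊆ vs⊆) , f′
...     | inj₂ (_ , _ , refl , refl) = _ , ++⁺ ys⊆ (refl ∷ ++⁺ z∷zs⊆ ws⊆) , swapLast f

containsForbidden-moveRight : All (a <_) M → Maybe.All (_≤ a) (last L) →
  ContainsForbidden (L ++ a ∷ M ++ R) → ContainsForbidden (L ++ M ++ a ∷ R)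
containsForbidden-moveRight {a = a} {L = L} a<M L≤a (_ , xs⊆ , f) with ⊆-++-split L xs⊆
... | ys , _ , refl , ys⊆ , t⊆ with ⊆-moveRight t⊆
...   | inj₁ t⊆′ = _ , ++⁺ ys⊆ t⊆′ , f
...   | inj₂ (z , zs , ws , refl , z∷zs⊆ , ws⊆)
        with adjacentAscentPositions ys f (All.head (All-resp-⊆ z∷zs⊆ a<M))
...     | inj₁ (_ , refl) =
          let _ , ub⊆ , f′ = lowerSecondTo-last f ys⊆ L≤a
          in _ , ++⁺ ub⊆ (++⁺ z∷zs⊆ (a ∷ʳ ws⊆)) , f′
...     | inj₂ (_ , _ , refl , zs++ws≡[])
          with refl ← ++-conicalˡ zs ws zs++ws≡[] | refl ← ++-conicalʳ zs ws zs++ws≡[] =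
          _ , ++⁺ ys⊆ (++⁺ z∷zs⊆ (refl ∷ ws⊆)) , swapLast f

containsForbidden-swapBlocks : ∀ L M₂ M₃ R →
  Maybe.All (_≤ a) (last L) → Maybe.All (_≤ a) (head R) →
  All (a <_) M₂ → All (a <_) M₃ → M₂ ≡ [] ⊎ M₃ ≡ [] →
  ContainsForbidden (L ++ M₃ ++ a ∷ M₂ ++ R) → ContainsForbidden (L ++ M₂ ++ a ∷ M₃ ++ R)
containsForbidden-swapBlocks _ .[] _ _ _ R≤a _ a<M₃ (inj₁ refl) =
  containsForbidden-moveLeft a<M₃ R≤a
containsForbidden-swapBlocks _ _ .[] _ L≤a _ a<M₂ _ (inj₂ refl) =
  containsForbidden-moveRight a<M₂ L≤a

pre-++-post : a ∈ π → pre a π ++ a ∷ post a π ≡ π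
pre-++-post {a} {x ∷ π} a∈ with x ≡ᵇ a in x≡ᵇa
... | true = cong (_∷ π) (sym (≡ᵇ⇒≡ x a (subst T (sym x≡ᵇa) tt)))
pre-++-post {a} {x ∷ π} (here refl) | false = ⊥-elim (subst T x≡ᵇa (≡⇒≡ᵇ x x refl))
pre-++-post {a} {x ∷ π} (there a∈) | false = cong (x ∷_) (pre-++-post a∈)

w1-++-w2 : ∀ a π → w1 a π ++ w2 a π ≡ pre a π
w1-++-w2 a π = begin
  reverse D ++ reverse T′ ≡⟨ reverse-++ T′ D ⟨
  reverse (T′ ++ D)       ≡⟨ cong reverse (takeWhile++dropWhile _ ρ) ⟩
  reverse ρ               ≡⟨ reverse-involutive (pre a π) ⟩
  pre a π                 ∎
  where
  open ≡-Reasoning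
  ρ = reverse (pre a π)
  T′ = takeWhileᵇ (a <ᵇ_) ρ
  D = dropWhileᵇ (a <ᵇ_) ρ

w3-++-w4 : ∀ a π → w3 a π ++ w4 a π ≡ post a π
w3-++-w4 a π = takeWhile++dropWhile _ (post a π)

factorise : a ∈ π → π ≡ w1 a π ++ w2 a π ++ a ∷ w3 a π ++ w4 a π
factorise {a} {π} a∈π = begin
  π                                          ≡⟨ pre-++-post a∈π ⟨
  pre a π ++ a ∷ post a π                    ≡⟨ cong₂ (λ l r → l ++ a ∷ r) (w1-++-w2 a π) (w3-++-w4 a π) ⟨
  (w1 a π ++ w2 a π) ++ a ∷ w3 a π ++ w4 a π ≡⟨ ++-assoc (w1 a π) (w2 a π) _ ⟩
  w1 a π ++ w2 a π ++ a ∷ w3 a π ++ w4 a π   ∎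
  where open ≡-Reasoning

takeWhile-above : ∀ a xs → All (a <_) (takeWhileᵇ (a <ᵇ_) xs)
takeWhile-above a xs = All.map (<ᵇ⇒< a _) (all-takeWhile (T? ∘ (a <ᵇ_)) xs)

dropWhile-head-≤ : ∀ a xs → Maybe.All (_≤ a) (head (dropWhileᵇ (a <ᵇ_) xs))
dropWhile-head-≤ a xs =
  Maybe.map (λ a≮x → ≮⇒≥ (a≮x ∘ <⇒<ᵇ)) (all-head-dropWhile (T? ∘ (a <ᵇ_)) xs)

w2-above : ∀ a π → All (a <_) (w2 a π)
w2-above a π = All-resp-↭ (↭-sym (↭-reverse _)) (takeWhile-above a (reverse (pre a π)))

w3-above : ∀ a π → All (a <_) (w3 a π)
w3-above a π = takeWhile-above a (post a π)

w1-last-≤ : ∀ a π → Maybe.All (_≤ a) (last (w1 a π))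
w1-last-≤ a π =
  subst (Maybe.All _) (sym (last-reverse _)) (dropWhile-head-≤ a (reverse (pre a π)))

w4-head-≤ : ∀ a π → Maybe.All (_≤ a) (head (w4 a π))
w4-head-≤ a π = dropWhile-head-≤ a (post a π)

takeWhile-≡[] : ∀ xs → Maybe.All (_< a) (head xs) → takeWhileᵇ (a <ᵇ_) xs ≡ []
takeWhile-≡[] [] _ = refl
takeWhile-≡[] {a} (x ∷ _) (Maybe.just x<a) with a <ᵇ x in a<ᵇx
... | false = refl
... | true = ⊥-elim (<-asym x<a (<ᵇ⇒< a x (subst T (sym a<ᵇx) tt)))

leftLess⇒< : ∀ m → T (leftLess m a) → Maybe.All (_< a) m
leftLess⇒< nothing _ = Maybe.nothing
leftLess⇒< {a} (just x) x<ᵇa = Maybe.just (<ᵇ⇒< x a x<ᵇa)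

rightLess⇒< : ∀ m → T (rightLess a m) → Maybe.All (_< a) m
rightLess⇒< nothing _ = Maybe.nothing
rightLess⇒< {a} (just x) x<ᵇa = Maybe.just (<ᵇ⇒< x a x<ᵇa)

doubleAscOrDesc⇒w2⊎w3≡[] : ∀ a π → T (isDoubleAscOrDesc a π) → w2 a π ≡ [] ⊎ w3 a π ≡ []
doubleAscOrDesc⇒w2⊎w3≡[] a π double with Equivalence.to T-∨ double
... | inj₁ asc = inj₁ (cong reverse (takeWhile-≡[] (reverse (pre a π))
        (subst (Maybe.All _) last≡head (leftLess⇒< _ (proj₁ (Equivalence.to T-∧ asc))))))
  where
  last≡head : last (pre a π) ≡ head (reverse (pre a π))
  last≡head = trans (cong last (sym (reverse-involutive (pre a π)))) (last-reverse (reverse (pre a π)))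
... | inj₂ desc = inj₂ (takeWhile-≡[] (post a π) (rightLess⇒< _ (proj₂ (Equivalence.to T-∧ desc))))

φ′-cases : ∀ a π → (φ′ a π ≡ φ a π × T (isDoubleAscOrDesc a π)) ⊎ φ′ a π ≡ π
φ′-cases a π with isDoubleAscOrDesc a π
... | true = inj₁ (refl , tt)
... | false = inj₂ refl

φ-↭ : a ∈ π → φ a π ↭ π
φ-↭ {a} {π} a∈π = ↭-trans (↭-++⁺ˡ (w1 a π) (↭-swapAround a (w3 a π) (w2 a π) (w4 a π)))
  (↭-reflexive (sym (factorise a∈π)))

φ′-↭ : a ∈ π → φ′ a π ↭ π
φ′-↭ {a} {π} a∈π with φ′-cases a π
... | inj₁ (φ′≡φ , _) = ↭-trans (↭-reflexive φ′≡φ) (φ-↭ a∈π)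
... | inj₂ φ′≡π = ↭-reflexive φ′≡π

φ′-reflects-forbidden : a ∈ π → ContainsForbidden (φ′ a π) → ContainsForbidden π
φ′-reflects-forbidden {a} {π} a∈π c with φ′-cases a π
... | inj₂ φ′≡π = subst ContainsForbidden φ′≡π c
... | inj₁ (φ′≡φ , double) = subst ContainsForbidden (sym (factorise a∈π))
  (containsForbidden-swapBlocks (w1 a π) (w2 a π) (w3 a π) (w4 a π)
    (w1-last-≤ a π) (w4-head-≤ a π)
    (w2-above a π) (w3-above a π) (doubleAscOrDesc⇒w2⊎w3≡[] a π double)
    (subst ContainsForbidden φ′≡φ c))

perm-∈ : ∀ {n} → IsPerm n π → 1 ≤ a → a ≤ n → a ∈ π
perm-∈ {a = suc _} π↭ (s≤s _) a≤n = ∈-resp-↭ (↭-sym π↭) (∈-map⁺ suc (∈-upTo⁺ a≤n))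

lemma3p4 : (n : ℕ) → 1 ≤ n → (π : List ℕ) → IsPerm n π →
    Avoids π ((2 ∷ 1 ∷ 3 ∷ 4 ∷ []) ∷ (2 ∷ 1 ∷ 4 ∷ 3 ∷ []) ∷ []) →
    (a : ℕ) → 1 ≤ a → a ≤ n →
    IsPerm n (φ′ a π) × Avoids (φ′ a π) ((2 ∷ 1 ∷ 3 ∷ 4 ∷ []) ∷ (2 ∷ 1 ∷ 4 ∷ 3 ∷ []) ∷ [])
lemma3p4 n _ π π↭ π-avoids a 1≤a a≤n =
  ↭-trans (φ′-↭ a∈π) π↭ ,
  ¬containsForbidden⇒avoids (avoids⇒¬containsForbidden π-avoids ∘ φ′-reflects-forbidden a∈π)
  where
  a∈π : a ∈ π
  a∈π = perm-∈ π↭ 1≤a a≤n
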